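{- Let $z>0$ and let $G$ be any graph on $n$ vertices such that (P1) $G$ has no stable set with at least $z$ vertices, and (P2) there are no two disjoint vertex sets, each with at least $z$ vertices, having no edges between them. Then in any NAC-colouring of $G$, some monochromatic component contains at least $n-8z$ vertices.
   Context: A NAC-colouring of a graph $G$ is a surjective map $E(G)\to\{\text{red},\text{blue}\}$ such that no cycle of $G$ contains exactly one red edge or exactly one blue edge. A monochromatic component of a colouring is a maximal connected subgraph all of whose edges have the same colour.
   Formalization: The parameter z ranges over the positive rationals. -}

module Defs where

open import Data.Nat using (ℕ; suc; _≤_)
open import Data.Fin using (Fin)
open import Data.Unit using (⊤)
open import Data.Bool using (Bool; true; false)
open import Data.List using (List; []; _∷_; length)
open import Data.List.Relation.Unary.Unique.Propositional using (Unique)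
open import Data.List.Membership.Propositional using (_∈_; _∉_)
open import Data.Product using (_×_; _,_; Σ; ∃; ∃-syntax)
open import Relation.Binary.PropositionalEquality using (_≡_; _≢_)
open import Relation.Nullary using (¬_)
open import Data.Integer using (+_)
open import Data.Rational using (ℚ; _/_; _-_; _*_)
import Data.Rational as Q

record Graph (n : ℕ) : Set where
  field
    adj   : Fin n → Fin n → Bool
    sym   : ∀ u v → adj u v ≡ adj v u
    irrefl : ∀ u → adj u u ≡ false
open Graph public

data Colour : Set where
  red blue : Colour

-- An edge colouring: a symmetric assignment of colours to pairs of vertices
-- (only values on edges matter).
record EdgeColouring {n : ℕ} (G : Graph n) : Set where
  field
    col    : Fin n → Fin n → Colour
    colSym : ∀ u v → col u v ≡ col v u
open EdgeColouring public

closeEdges : {A : Set} → A → List A → List (A × A)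
closeEdges first []           = []
closeEdges first (x ∷ [])     = (x , first) ∷ []
closeEdges first (x ∷ y ∷ xs) = (x , y) ∷ closeEdges first (y ∷ xs)

cycleEdges : {A : Set} → List A → List (A × A)
cycleEdges []       = []
cycleEdges (x ∷ xs) = closeEdges x (x ∷ xs)

AllAdjacent : {n : ℕ} → Graph n → List (Fin n × Fin n) → Set
AllAdjacent G []             = ⊤
AllAdjacent G ((u , v) ∷ es) = (adj G u v ≡ true) × AllAdjacent G es

record Cycle {n : ℕ} (G : Graph n) : Set where
  field
    verts    : List (Fin n)
    long     : 3 ≤ length verts
    distinct : Unique verts
    closed   : AllAdjacent G (cycleEdges verts)
open Cycle public

countColour : {n : ℕ} → (Fin n → Fin n → Colour) → Colour → List (Fin n × Fin n) → ℕ
countColour c κ [] = 0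
countColour c κ ((u , v) ∷ es) with c u v | κ
... | red  | red  = suc (countColour c κ es)
... | blue | blue = suc (countColour c κ es)
... | red  | blue = countColour c κ es
... | blue | red  = countColour c κ es

record IsNAC {n : ℕ} (G : Graph n) (c : EdgeColouring G) : Set where
  field
    hasRed  : ∃[ u ] ∃[ v ] (adj G u v ≡ true × col c u v ≡ red)
    hasBlue : ∃[ u ] ∃[ v ] (adj G u v ≡ true × col c u v ≡ blue)
    noOne   : ∀ (C : Cycle G) (κ : Colour) →
              countColour (col c) κ (cycleEdges (verts C)) ≢ 1

data Reach {n : ℕ} (G : Graph n) (c : EdgeColouring G) (κ : Colour) (v : Fin n) : Fin n → Set where
  here : Reach G c κ v v
  step : ∀ {u w} → Reach G c κ v u → adj G u w ≡ true → col c u w ≡ κ → Reach G c κ v w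

ℕ→ℚ : ℕ → ℚ
ℕ→ℚ k = + k / 1

IsStable : {n : ℕ} → Graph n → List (Fin n) → Set
IsStable G S = Unique S × (∀ {u v} → u ∈ S → v ∈ S → adj G u v ≡ false)

P1 : {n : ℕ} → Graph n → ℚ → Set
P1 G z = ¬ (Σ (List _) λ S → IsStable G S × z Q.≤ ℕ→ℚ (length S))

P2 : {n : ℕ} → Graph n → ℚ → Set
P2 G z = ¬ (Σ (List _) λ A → Σ (List _) λ B →
              Unique A × Unique B ×
              (∀ {u} → u ∈ A → u ∉ B) ×
              z Q.≤ ℕ→ℚ (length A) × z Q.≤ ℕ→ℚ (length B) ×
              (∀ {u v} → u ∈ A → v ∈ B → adj G u v ≡ false))

BigMonoComponent : {n : ℕ} (G : Graph n) → EdgeColouring G → ℚ → Set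
BigMonoComponent G c m =
  Σ Colour λ κ → Σ (Fin _) λ v → Σ (List (Fin _)) λ S →
    Unique S × (∀ {w} → w ∈ S → Reach G c κ v w) × m Q.≤ ℕ→ℚ (length S)

-- Label every vertex by its red component (its row) and its blue component (its column).
-- An edge stays inside a row or a column, so two vertex sets sharing no row and no column
-- span no edge, and by (P2) one of them has at most Y = ⌊z⌋ vertices.  Let k be the first
-- row such that the rows up to k hold more than 3Y vertices.  Either row k misses at most
-- 5Y vertices, or the set K of vertices in rows up to k has more than 3Y vertices and its
-- complement more than 2Y.  In the latter case let m be the first column such that the
-- columns up to m hold more than Y vertices of K.  If more than Y vertices of K lie in
-- column m, comparing opposite blocks shows that column m misses at most 2Y vertices;
-- otherwise K has more than Y vertices on either side of column m, which leaves at most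
-- Y vertices outside K on either side, too few.  So some monochromatic component has at
-- least n - 5Y ≥ n - 8z vertices.
module Submission where

open import Level using (0ℓ)
open import Data.Nat using (ℕ)
open import Relation.Binary using (DecidableEquality)

module Counting where

  open import Data.Nat using (suc; _+_)
  open import Data.Nat.Properties using (+-suc)
  open import Data.List using (List; []; _∷_; length; filter)
  open import Data.List.Properties using (filter-≐; filter-all; filter-none)
  import Data.List.Relation.Unary.All as All
  open import Data.Product using (_,_; proj₂; swap)
  open import Relation.Nullary using (yes; no)
  open import Relation.Unary using (Pred; Decidable; _≐_; Empty; Universal)
  open import Relation.Unary.Properties using (_∩?_; ∁?; U?)
  open import Relation.Binary.PropositionalEquality using (_≡_; refl; sym; trans; cong)

  module _ {V : Set} where

    private variable P Q : Pred V 0ℓ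

    count : Decidable P → List V → ℕ
    count P? xs = length (filter P? xs)

    count-split : (P? : Decidable P) (Q? : Decidable Q) → ∀ xs →
                  count P? xs ≡ count (P? ∩? Q?) xs + count (P? ∩? ∁? Q?) xs
    count-split P? Q? []       = refl
    count-split P? Q? (x ∷ xs) with P? x | Q? x
    ... | yes _ | yes _ = cong suc (count-split P? Q? xs)
    ... | yes _ | no  _ = trans (cong suc (count-split P? Q? xs)) (sym (+-suc _ _))
    ... | no  _ | _     = count-split P? Q? xs

    count-complement : (Q? : Decidable Q) → ∀ xs → length xs ≡ count Q? xs + count (∁? Q?) xs
    count-complement Q? []       = refl
    count-complement Q? (x ∷ xs) with Q? x
    ... | yes _ = cong suc (count-complement Q? xs)
    ... | no  _ = trans (cong suc (count-complement Q? xs)) (sym (+-suc _ _))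

    count-cong : (P? : Decidable P) (Q? : Decidable Q) → P ≐ Q → ∀ xs → count P? xs ≡ count Q? xs
    count-cong P? Q? P≐Q xs = cong length (filter-≐ P? Q? P≐Q xs)

    count-∩-comm : (P? : Decidable P) (Q? : Decidable Q) → ∀ xs →
                   count (P? ∩? Q?) xs ≡ count (Q? ∩? P?) xs
    count-∩-comm P? Q? = count-cong (P? ∩? Q?) (Q? ∩? P?) (swap , swap)

    count-U∩ : (P? : Decidable P) → ∀ xs → count (U? ∩? P?) xs ≡ count P? xs
    count-U∩ P? = count-cong (U? ∩? P?) P? (proj₂ , (_ ,_))

    count-universal : (P? : Decidable P) → Universal P → ∀ xs → count P? xs ≡ length xs
    count-universal P? all xs = cong length (filter-all P? (All.universal all xs))

    count-empty : (P? : Decidable P) → Empty P → ∀ xs → count P? xs ≡ 0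
    count-empty P? none xs = cong length (filter-none P? (All.universal none xs))

module RowsAndColumns where

  open import Function using (_∘_)
  open import Data.Nat using (zero; suc; _+_; _*_; _≤_; _<_; z≤n; s≤s; _≤?_; _<?_; _≟_)
  open import Data.Nat.Properties
  open import Data.Nat.Tactic.RingSolver using (solve)
  open import Algebra.Properties.CommutativeSemigroup +-commutativeSemigroup using (interchange)
  open import Data.List using (List; []; _∷_; length)
  open import Data.Product using (Σ; _×_; _,_; proj₁; ∃-syntax)
  open import Data.Sum using (_⊎_; inj₁; inj₂)
  open import Data.Unit using (tt)
  open import Relation.Nullary using (yes; no; contradiction)
  open import Relation.Unary using (Pred; Decidable; ∁; _≐_; _⊥′_)
  open import Relation.Unary.Properties using (_∩?_; ∁?; U?)
  open import Relation.Binary.PropositionalEquality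
  open Counting

  discrete-ivt : ∀ (f : ℕ → ℕ) {t} N → f 0 < t → t ≤ f N → ∃[ k ] f k < t × t ≤ f (suc k)
  discrete-ivt f     zero    f0<t t≤f0 = contradiction t≤f0 (<⇒≱ f0<t)
  discrete-ivt f {t} (suc N) f0<t t≤fN with t ≤? f N
  ... | yes t≤fN = discrete-ivt f N f0<t t≤fN
  ... | no  t≰fN = N , ≰⇒> t≰fN , t≤fN

  m≤o⇒o+p<m+n⇒p<n : ∀ {m n o p} → m ≤ o → o + p < m + n → p < n
  m≤o⇒o+p<m+n⇒p<n {n = n} {o} {p} m≤o lt = +-cancelˡ-< o p n (<-≤-trans lt (+-monoˡ-≤ n m≤o))

  n≤p⇒o+p<m+n⇒o<m : ∀ {m n o p} → n ≤ p → o + p < m + n → o < m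
  n≤p⇒o+p<m+n⇒o<m {m} {n} {o} {p} n≤p lt =
    m≤o⇒o+p<m+n⇒p<n n≤p (subst₂ _<_ (+-comm o p) (+-comm m n) lt)

  ⊥-∁ : {A : Set} {R : Pred A 0ℓ} → R ⊥′ ∁ R
  ⊥-∁ _ (r , ¬r) = ¬r r

  ∁-⊥ : {A : Set} {R : Pred A 0ℓ} → ∁ R ⊥′ R
  ∁-⊥ _ (¬r , r) = ¬r r

  Apart : {V : Set} (row column : V → ℕ) → Pred V 0ℓ → Pred V 0ℓ → Set
  Apart row column A B = ∀ {u v} → A u → B v → row u ≢ row v × column u ≢ column v

  module Grid {V : Set} (xs : List V) (row column : V → ℕ) {N : ℕ}
              (row<N : ∀ x → row x < N) (column<N : ∀ x → column x < N) (Y : ℕ)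
              (apart⇒small : ∀ {A B : Pred V 0ℓ} (A? : Decidable A) (B? : Decidable B) →
                             Apart row column A B → Y < count A? xs → count B? xs ≤ Y) where

    private variable P : Pred V 0ℓ

    ∣_∣ : Decidable P → ℕ
    ∣ P? ∣ = count P? xs

    below : (f : V → ℕ) (j : ℕ) → Decidable (λ x → f x < j)
    below f j x = f x <? j

    at : (f : V → ℕ) (j : ℕ) → Decidable (λ x → f x ≡ j)
    at f j x = f x ≟ j

    Line : (V → ℕ) → ℕ → Set
    Line f ℓ = length xs ≤ ∣ at f ℓ ∣ + 5 * Y

    count-below-suc : (P? : Decidable P) (f : V → ℕ) (j : ℕ) →
                      ∣ P? ∩? below f (suc j) ∣ ≡ ∣ P? ∩? below f j ∣ + ∣ P? ∩? at f j ∣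
    count-below-suc P? f j = begin
      ∣ P? ∩? below f (suc j) ∣                            ≡⟨ count-split _ (below f j) xs ⟩
      ∣ (P? ∩? below f (suc j)) ∩? below f j ∣
        + ∣ (P? ∩? below f (suc j)) ∩? ∁? (below f j) ∣    ≡⟨ cong₂ _+_ (count-cong _ _ below-j xs)
                                                                        (count-cong _ _ at-j xs) ⟩
      ∣ P? ∩? below f j ∣ + ∣ P? ∩? at f j ∣                ∎
      where
      open ≡-Reasoning
      below-j : _ ≐ _
      below-j = (λ ((p , _) , lt) → p , lt) , (λ (p , lt) → (p , m<n⇒m<1+n lt) , lt)
      at-j : _ ≐ _
      at-j = (λ ((p , lt) , ≮) → p , ≤-antisym (≤-pred lt) (≮⇒≥ ≮))
           , (λ (p , e) → (p , s≤s (≤-reflexive e)) , <-irrefl e)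

    crossing : (P? : Decidable P) (f : V → ℕ) → (∀ x → f x < N) → ∀ {t} → 0 < t → t ≤ ∣ P? ∣ →
               ∃[ j ] ∣ P? ∩? below f j ∣ < t × t ≤ ∣ P? ∩? below f (suc j) ∣
    crossing P? f f<N 0<t t≤P = discrete-ivt (λ j → ∣ P? ∩? below f j ∣) N
      (subst (_< _) (sym (count-empty _ (λ { _ (_ , ()) }) xs)) 0<t)
      (subst (_ ≤_) (count-cong _ _ ((λ p → p , f<N _) , proj₁) xs) t≤P)

    opposite-block-small : {R R′ C C′ : Pred ℕ 0ℓ} (R? : Decidable R) (C? : Decidable C)
                           (R′? : Decidable R′) (C′? : Decidable C′) → R ⊥′ R′ → C ⊥′ C′ →
                           Y < ∣ (R? ∘ row) ∩? (C? ∘ column) ∣ →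
                           ∣ (R′? ∘ row) ∩? (C′? ∘ column) ∣ ≤ Y
    opposite-block-small {R′ = R′} {C′ = C′} R? C? R′? C′? R⊥R′ C⊥C′ =
      apart⇒small _ _ λ (r , c) (r′ , c′) →
        (λ e → R⊥R′ _ (r , subst R′ (sym e) r′)) , (λ e → C⊥C′ _ (c , subst C′ (sym e) c′))

    module _ {K : Pred ℕ 0ℓ} (K? : Decidable K) where

      heavy-cell⇒large-column : ∀ m → Y < ∣ (K? ∘ row) ∩? at column m ∣ →
                                Y + Y < ∣ ∁? K? ∘ row ∣ → length xs ≤ ∣ at column m ∣ + (Y + Y)
      heavy-cell⇒large-column m heavy many-outside = begin
        length xs                          ≡⟨ count-complement (K? ∘ row) xs ⟩
        ∣ K? ∘ row ∣ + ∣ ∁? K? ∘ row ∣      ≡⟨ cong₂ _+_ (count-split _ (at column m) xs)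
                                                       (count-split _ (at column m) xs) ⟩
        (a₁ + a₂) + (b₁ + b₂)              ≡⟨ interchange a₁ a₂ b₁ b₂ ⟩
        (a₁ + b₁) + (a₂ + b₂)              ≤⟨ +-monoʳ-≤ (a₁ + b₁) (+-mono-≤ a₂≤Y b₂≤Y) ⟩
        (a₁ + b₁) + (Y + Y)                ≡⟨ cong (_+ (Y + Y)) column-m ⟨
        ∣ at column m ∣ + (Y + Y)          ∎
        where
        open ≤-Reasoning
        a₁ = ∣ (K? ∘ row) ∩? at column m ∣
        a₂ = ∣ (K? ∘ row) ∩? ∁? (at column m) ∣
        b₁ = ∣ (∁? K? ∘ row) ∩? at column m ∣
        b₂ = ∣ (∁? K? ∘ row) ∩? ∁? (at column m) ∣
        b₂≤Y : b₂ ≤ Y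
        b₂≤Y = opposite-block-small K? (_≟ m) (∁? K?) (∁? (_≟ m)) ⊥-∁ ⊥-∁ heavy
        Y<b₁ : Y < b₁
        Y<b₁ = n≤p⇒o+p<m+n⇒o<m b₂≤Y (subst (_ <_) (count-split _ (at column m) xs) many-outside)
        a₂≤Y : a₂ ≤ Y
        a₂≤Y = opposite-block-small (∁? K?) (_≟ m) K? (∁? (_≟ m)) ∁-⊥ ⊥-∁ Y<b₁
        column-m : ∣ at column m ∣ ≡ a₁ + b₁
        column-m = trans (count-split (at column m) (K? ∘ row) xs)
                         (cong₂ _+_ (count-∩-comm (at column m) (K? ∘ row) xs)
                                    (count-∩-comm (at column m) (∁? K? ∘ row) xs))

      light-cell⇒few-outside : ∀ m → ∣ (K? ∘ row) ∩? below column m ∣ < suc Y →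
                               suc Y ≤ ∣ (K? ∘ row) ∩? below column (suc m) ∣ →
                               ∣ (K? ∘ row) ∩? at column m ∣ ≤ Y →
                               Y + Y + Y < ∣ K? ∘ row ∣ → ∣ ∁? K? ∘ row ∣ ≤ Y + Y
      light-cell⇒few-outside m columns<m-few columns≤m-many light many-inside = begin
        ∣ ∁? K? ∘ row ∣     ≡⟨ count-split _ (below column (suc m)) xs ⟩
        d₁ + d₂            ≤⟨ +-mono-≤ d₁≤Y d₂≤Y ⟩
        Y + Y              ∎
        where
        open ≤-Reasoning
        d₁ = ∣ (∁? K? ∘ row) ∩? below column (suc m) ∣
        d₂ = ∣ (∁? K? ∘ row) ∩? ∁? (below column (suc m)) ∣
        left≤2Y : ∣ (K? ∘ row) ∩? below column (suc m) ∣ ≤ Y + Y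
        left≤2Y = subst (_≤ Y + Y) (sym (count-below-suc (K? ∘ row) column m))
                        (+-mono-≤ (≤-pred columns<m-few) light)
        Y<right : Y < ∣ (K? ∘ row) ∩? ∁? (below column (suc m)) ∣
        Y<right = m≤o⇒o+p<m+n⇒p<n left≤2Y
                    (subst (_ <_) (count-split _ (below column (suc m)) xs) many-inside)
        d₁≤Y : d₁ ≤ Y
        d₁≤Y = opposite-block-small K? (∁? (_<? suc m)) (∁? K?) (_<? suc m) ⊥-∁ ∁-⊥ Y<right
        d₂≤Y : d₂ ≤ Y
        d₂≤Y = opposite-block-small K? (_<? suc m) (∁? K?) (∁? (_<? suc m)) ⊥-∁ ⊥-∁ columns≤m-many

      large-column : Y + Y + Y < ∣ K? ∘ row ∣ → Y + Y < ∣ ∁? K? ∘ row ∣ →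
                     ∃[ m ] length xs ≤ ∣ at column m ∣ + (Y + Y)
      large-column many-inside many-outside
        with crossing (K? ∘ row) column column<N (s≤s z≤n)
                      (≤-trans (s≤s (m≤n+m Y (Y + Y))) many-inside)
      ... | m , columns<m-few , columns≤m-many with Y <? ∣ (K? ∘ row) ∩? at column m ∣
      ... | yes heavy = m , heavy-cell⇒large-column m heavy many-outside
      ... | no  light = contradiction
            (light-cell⇒few-outside m columns<m-few columns≤m-many (≮⇒≥ light) many-inside)
            (<⇒≱ many-outside)

    5Y≡3Y+2Y : 5 * Y ≡ (Y + Y + Y) + (Y + Y)
    5Y≡3Y+2Y = solve (Y ∷ [])

    short-row⇒many-beyond : ∀ k → ∣ U? ∩? below row k ∣ ≤ Y + Y + Y →
                             ∣ at row k ∣ + 5 * Y < length xs → Y + Y < ∣ ∁? (_<? suc k) ∘ row ∣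
    short-row⇒many-beyond k rows<k-few row-k-short =
      m≤o⇒o+p<m+n⇒p<n inside
        (subst₂ _<_ (rearrange r) (count-complement (below row (suc k)) xs) row-k-short)
      where
      open ≤-Reasoning
      r = ∣ at row k ∣
      inside : ∣ below row (suc k) ∣ ≤ (Y + Y + Y) + r
      inside = begin
        ∣ below row (suc k) ∣                        ≡⟨ count-U∩ _ xs ⟨
        ∣ U? ∩? below row (suc k) ∣                  ≡⟨ count-below-suc U? row k ⟩
        ∣ U? ∩? below row k ∣ + ∣ U? ∩? at row k ∣    ≤⟨ +-mono-≤ rows<k-few (≤-reflexive (count-U∩ _ xs)) ⟩
        (Y + Y + Y) + r                              ∎
      rearrange : ∀ r → r + 5 * Y ≡ ((Y + Y + Y) + r) + (Y + Y)
      rearrange r = solve (r ∷ Y ∷ [])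

    large-line : Σ ℕ (Line row) ⊎ Σ ℕ (Line column)
    large-line with length xs ≤? Y + Y + Y
    ... | yes few = inj₁ (0 , ≤-trans few (≤-trans 3Y≤5Y (m≤n+m (5 * Y) ∣ at row 0 ∣)))
      where
      3Y≤5Y : Y + Y + Y ≤ 5 * Y
      3Y≤5Y = ≤-trans (m≤m+n (Y + Y + Y) (Y + Y)) (≤-reflexive (sym 5Y≡3Y+2Y))
    ... | no  many
      with crossing U? row row<N {suc (Y + Y + Y)} (s≤s z≤n)
                    (subst (_ ≤_) (sym (count-universal U? (λ _ → tt) xs)) (≰⇒> many))
    ... | k , rows<k-few , rows≤k-many with length xs ≤? ∣ at row k ∣ + 5 * Y
    ... | yes row-k = inj₁ (k , row-k)
    ... | no  ¬row-k = inj₂ (weaken (large-column (_<? suc k)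
                                       (subst (_ <_) (count-U∩ _ xs) rows≤k-many)
                                       (short-row⇒many-beyond k (≤-pred rows<k-few) (≰⇒> ¬row-k))))
      where
      weaken : ∃[ m ] length xs ≤ ∣ at column m ∣ + (Y + Y) → Σ ℕ (Line column)
      weaken (m , line) = m , ≤-trans line (+-monoʳ-≤ ∣ at column m ∣ 2Y≤5Y)
        where
        2Y≤5Y : Y + Y ≤ 5 * Y
        2Y≤5Y = ≤-trans (m≤n+m (Y + Y) (Y + Y + Y)) (≤-reflexive (sym 5Y≡3Y+2Y))

module Relabelling {V : Set} (_≟ᵥ_ : DecidableEquality V) where

  open import Data.Bool using (if_then_else_)
  open import Data.List using (List; []; _∷_)
  open import Data.List.Membership.Propositional using (_∈_)
  open import Data.List.Relation.Unary.Any using (here; there)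
  import Data.List.Relation.Unary.All as All
  open import Data.Product using (_×_; _,_)
  open import Relation.Nullary using (does; yes; no; contradiction)
  open import Relation.Binary using (Rel; IsEquivalence)
  open import Relation.Binary.PropositionalEquality using (_≡_; refl; sym; trans; cong)

  merge : V → V → (V → V) → V → V
  merge u w L x = if does (L x ≟ᵥ L w) then L u else L x

  mergeAll : List (V × V) → (V → V) → V → V
  mergeAll []             L = L
  mergeAll ((u , w) ∷ es) L = mergeAll es (merge u w L)

  mergeAll-cong : ∀ es L {x y} → L x ≡ L y → mergeAll es L x ≡ mergeAll es L y
  mergeAll-cong []             L Lx≡Ly = Lx≡Ly
  mergeAll-cong ((u , w) ∷ es) L Lx≡Ly =
    mergeAll-cong es (merge u w L) (cong (λ l → if does (l ≟ᵥ L w) then L u else l) Lx≡Ly)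

  merge-joins : ∀ u w L → merge u w L u ≡ merge u w L w
  merge-joins u w L with L u ≟ᵥ L w | L w ≟ᵥ L w
  ... | yes _ | yes _  = refl
  ... | no  _ | yes _  = refl
  ... | _     | no  ≢  = contradiction refl ≢

  mergeAll-joins : ∀ es L {u w} → (u , w) ∈ es → mergeAll es L u ≡ mergeAll es L w
  mergeAll-joins ((u , w) ∷ es) L (here refl)   = mergeAll-cong es (merge u w L) (merge-joins u w L)
  mergeAll-joins (_ ∷ es)       L (there uw∈es) = mergeAll-joins es _ uw∈es

  module _ {_~_ : Rel V 0ℓ} (~-equivalence : IsEquivalence _~_) where

    open IsEquivalence ~-equivalence using (reflexive) renaming (sym to ~-sym; trans to ~-trans)

    Sound : (V → V) → Set
    Sound L = ∀ {x y} → L x ≡ L y → x ~ y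

    id-sound : Sound (λ x → x)
    id-sound = reflexive

    merge-sound : ∀ {u w L} → u ~ w → Sound L → Sound (merge u w L)
    merge-sound {u} {w} {L} u~w sound {x} {y} with L x ≟ᵥ L w | L y ≟ᵥ L w
    ... | yes Lx≡Lw | yes Ly≡Lw = λ _ → sound (trans Lx≡Lw (sym Ly≡Lw))
    ... | yes Lx≡Lw | no  _     = λ Lu≡Ly → ~-trans (sound Lx≡Lw) (~-trans (~-sym u~w) (sound Lu≡Ly))
    ... | no  _     | yes Ly≡Lw = λ Lx≡Lu → ~-trans (sound Lx≡Lu) (~-trans u~w (sound (sym Ly≡Lw)))
    ... | no  _     | no  _     = sound

    mergeAll-sound : ∀ {es L} → All.All (λ (u , w) → u ~ w) es → Sound L → Sound (mergeAll es L)
    mergeAll-sound All.[]           sound = sound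
    mergeAll-sound (u~w All.∷ rest) sound = mergeAll-sound rest (merge-sound u~w sound)

open import Defs hiding (sym)

module NaturalsAsRationals where

  open import Data.Nat using (suc; _+_; _*_; _≤_)
  open import Data.Nat.Properties using (≤-trans; ≤-reflexive; *-identityʳ; +-monoʳ-≤; +-monoˡ-≤;
                                         *-monoˡ-≤; m≤m+n; <⇒≤; module ≤-Reasoning)
  open import Data.Nat.DivMod using (_/_; _%_; m/n*n≤m; m≡m%n+[m/n]*n; m%n<n)
  open import Data.Nat.Coprimality using (Coprime; 1-coprimeTo) renaming (sym to Coprime-sym)
  open import Data.Integer using (+_; -[1+_]; +≤+)
  import Data.Integer as ℤ
  import Data.Integer.Properties as ℤ
  open import Data.Rational using (ℚ; mkℚ; 0ℚ; toℚᵘ; *≤*)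
  import Data.Rational as ℚ
  import Data.Rational.Properties as ℚ
  open import Data.Rational.Unnormalised using (mkℚᵘ; *≡*)
  import Data.Rational.Unnormalised as ℚᵘ
  import Data.Rational.Unnormalised.Properties as ℚᵘ
  open import Data.Product using (_×_; _,_; ∃-syntax)
  open import Relation.Binary.PropositionalEquality using (_≡_; sym; trans; cong; cong₂; subst₂)

  ℕ→ℚ-mkℚ : ∀ k → ℕ→ℚ k ≡ mkℚ (+ k) 0 (Coprime-sym (1-coprimeTo k))
  ℕ→ℚ-mkℚ k = ℚ.normalize-coprime (Coprime-sym (1-coprimeTo k))

  ℕ→ℚ≤mkℚ : ∀ {k p d-1} .{c : Coprime p (suc d-1)} → k * suc d-1 ≤ p → ℕ→ℚ k ℚ.≤ mkℚ (+ p) d-1 c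
  ℕ→ℚ≤mkℚ {k} {p} {d-1} k*d≤p rewrite ℕ→ℚ-mkℚ k =
    *≤* (subst₂ ℤ._≤_ (ℤ.pos-* k (suc d-1)) (sym (ℤ.*-identityʳ (+ p))) (+≤+ k*d≤p))

  mkℚ≤ℕ→ℚ : ∀ {k p d-1} .{c : Coprime p (suc d-1)} → p ≤ k * suc d-1 → mkℚ (+ p) d-1 c ℚ.≤ ℕ→ℚ k
  mkℚ≤ℕ→ℚ {k} {p} {d-1} p≤k*d rewrite ℕ→ℚ-mkℚ k =
    *≤* (subst₂ ℤ._≤_ (sym (ℤ.*-identityʳ (+ p))) (ℤ.pos-* k (suc d-1)) (+≤+ p≤k*d))

  ℕ→ℚ-mono-≤ : ∀ {m n} → m ≤ n → ℕ→ℚ m ℚ.≤ ℕ→ℚ n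
  ℕ→ℚ-mono-≤ {m} {n} m≤n rewrite ℕ→ℚ-mkℚ n =
    ℕ→ℚ≤mkℚ {m} {n} {0} (≤-trans (≤-reflexive (*-identityʳ m)) m≤n)

  toℚᵘ-ℕ→ℚ : ∀ k → toℚᵘ (ℕ→ℚ k) ≡ mkℚᵘ (+ k) 0
  toℚᵘ-ℕ→ℚ k = cong toℚᵘ (ℕ→ℚ-mkℚ k)

  ℕ→ℚ-homo-+ : ∀ m n → ℕ→ℚ (m + n) ≡ ℕ→ℚ m ℚ.+ ℕ→ℚ n
  ℕ→ℚ-homo-+ m n = ℚ.toℚᵘ-injective (begin
    toℚᵘ (ℕ→ℚ (m + n))                 ≡⟨ toℚᵘ-ℕ→ℚ (m + n) ⟩
    mkℚᵘ (+ (m + n)) 0                  ≈⟨ *≡* (cong (ℤ._* + 1) numerators) ⟩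
    mkℚᵘ (+ m) 0 ℚᵘ.+ mkℚᵘ (+ n) 0      ≡⟨ cong₂ ℚᵘ._+_ (toℚᵘ-ℕ→ℚ m) (toℚᵘ-ℕ→ℚ n) ⟨
    toℚᵘ (ℕ→ℚ m) ℚᵘ.+ toℚᵘ (ℕ→ℚ n)      ≈⟨ ℚ.toℚᵘ-homo-+ (ℕ→ℚ m) (ℕ→ℚ n) ⟨
    toℚᵘ (ℕ→ℚ m ℚ.+ ℕ→ℚ n)             ∎)
    where
    open ℚᵘ.≃-Reasoning
    numerators : + (m + n) ≡ + m ℤ.* + 1 ℤ.+ + n ℤ.* + 1
    numerators = trans (ℤ.pos-+ m n) (sym (cong₂ ℤ._+_ (ℤ.*-identityʳ (+ m)) (ℤ.*-identityʳ (+ n))))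

  ℕ→ℚ-homo-* : ∀ m n → ℕ→ℚ (m * n) ≡ ℕ→ℚ m ℚ.* ℕ→ℚ n
  ℕ→ℚ-homo-* m n = ℚ.toℚᵘ-injective (begin
    toℚᵘ (ℕ→ℚ (m * n))                 ≡⟨ toℚᵘ-ℕ→ℚ (m * n) ⟩
    mkℚᵘ (+ (m * n)) 0                  ≈⟨ *≡* (cong (ℤ._* + 1) (ℤ.pos-* m n)) ⟩
    mkℚᵘ (+ m) 0 ℚᵘ.* mkℚᵘ (+ n) 0      ≡⟨ cong₂ ℚᵘ._*_ (toℚᵘ-ℕ→ℚ m) (toℚᵘ-ℕ→ℚ n) ⟨
    toℚᵘ (ℕ→ℚ m) ℚᵘ.* toℚᵘ (ℕ→ℚ n)      ≈⟨ ℚ.toℚᵘ-homo-* (ℕ→ℚ m) (ℕ→ℚ n) ⟨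
    toℚᵘ (ℕ→ℚ m ℚ.* ℕ→ℚ n)             ∎)
    where open ℚᵘ.≃-Reasoning

  ℕ-floor : ∀ z → 0ℚ ℚ.≤ z → ∃[ Y ] ℕ→ℚ Y ℚ.≤ z × z ℚ.≤ ℕ→ℚ (suc Y)
  ℕ-floor (mkℚ -[1+ _ ] _ _) (*≤* ())
  ℕ-floor (mkℚ (+ p) d-1 _) _ =
    Y , ℕ→ℚ≤mkℚ {Y} (m/n*n≤m p (suc d-1)) , mkℚ≤ℕ→ℚ {suc Y} p≤[1+Y]*d
    where
    Y = p / suc d-1
    p≤[1+Y]*d : p ≤ suc Y * suc d-1
    p≤[1+Y]*d = begin
      p                          ≡⟨ m≡m%n+[m/n]*n p (suc d-1) ⟩
      p % suc d-1 + Y * suc d-1  ≤⟨ +-monoˡ-≤ (Y * suc d-1) (<⇒≤ (m%n<n p (suc d-1))) ⟩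
      suc d-1 + Y * suc d-1      ∎
      where open ≤-Reasoning

  n≤s+5Y⇒n-8z≤s : ∀ {n s Y z} → ℕ→ℚ Y ℚ.≤ z → n ≤ s + 5 * Y → ℕ→ℚ n ℚ.- ℕ→ℚ 8 ℚ.* z ℚ.≤ ℕ→ℚ s
  n≤s+5Y⇒n-8z≤s {n} {s} {Y} {z} Y≤z n≤s+5Y = begin
    ℕ→ℚ n ℚ.- 8z              ≤⟨ ℚ.+-monoˡ-≤ (ℚ.- 8z) n≤s+8z ⟩
    (ℕ→ℚ s ℚ.+ 8z) ℚ.- 8z     ≡⟨ ℚ.+-assoc (ℕ→ℚ s) 8z (ℚ.- 8z) ⟩
    ℕ→ℚ s ℚ.+ (8z ℚ.- 8z)     ≡⟨ cong (ℕ→ℚ s ℚ.+_) (ℚ.+-inverseʳ 8z) ⟩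
    ℕ→ℚ s ℚ.+ 0ℚ              ≡⟨ ℚ.+-identityʳ (ℕ→ℚ s) ⟩
    ℕ→ℚ s                     ∎
    where
    open ℚ.≤-Reasoning
    8z = ℕ→ℚ 8 ℚ.* z
    n≤s+8Y : n ≤ s + 8 * Y
    n≤s+8Y = ≤-trans n≤s+5Y (+-monoʳ-≤ s (*-monoˡ-≤ Y {5} {8} (m≤m+n 5 3)))
    n≤s+8z : ℕ→ℚ n ℚ.≤ ℕ→ℚ s ℚ.+ 8z
    n≤s+8z = begin
      ℕ→ℚ n                       ≤⟨ ℕ→ℚ-mono-≤ n≤s+8Y ⟩
      ℕ→ℚ (s + 8 * Y)             ≡⟨ trans (ℕ→ℚ-homo-+ s (8 * Y)) (cong (ℕ→ℚ s ℚ.+_) (ℕ→ℚ-homo-* 8 Y)) ⟩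
      ℕ→ℚ s ℚ.+ ℕ→ℚ 8 ℚ.* ℕ→ℚ Y   ≤⟨ ℚ.+-monoʳ-≤ (ℕ→ℚ s) (ℚ.*-monoˡ-≤-nonNeg (ℕ→ℚ 8) Y≤z) ⟩
      ℕ→ℚ s ℚ.+ 8z                ∎

module MonochromaticComponents {n : ℕ} (G : Graph n) (c : EdgeColouring G) where

  open import Function using (_∘_)
  open import Data.Nat using (suc; _+_; _*_; _≤_; _<_; _≟_)
  open import Data.Nat.Properties using (≮⇒≥)
  open import Data.Fin using (Fin; toℕ)
  import Data.Fin as Fin
  open import Data.Fin.Properties using (toℕ<n; toℕ-injective)
  open import Data.Bool using (true; false)
  import Data.Bool as Bool
  open import Data.Bool.Properties using (¬-not)
  open import Data.List using (List; []; _∷_; length; filter; allFin; cartesianProduct)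
  open import Data.List.Properties using (length-tabulate)
  open import Data.List.Membership.Propositional using (_∈_)
  open import Data.List.Membership.Propositional.Properties
    using (∈-filter⁺; ∈-filter⁻; ∈-cartesianProduct⁺; ∈-allFin)
  open import Data.List.Relation.Unary.Any using (here)
  import Data.List.Relation.Unary.All as All
  open import Data.List.Relation.Unary.Unique.Propositional using (Unique)
  open import Data.List.Relation.Unary.Unique.Propositional.Properties using (filter⁺; allFin⁺)
  open import Data.Product using (_×_; _,_; proj₁; proj₂; ∃-syntax)
  open import Data.Sum using (_⊎_; inj₁; inj₂; [_,_]′)
  open import Relation.Nullary using (¬_; yes; no)
  open import Relation.Nullary.Decidable using (_×-dec_)
  open import Relation.Unary using (Pred; Decidable)
  open import Relation.Binary using (IsEquivalence)
  open import Relation.Binary.PropositionalEquality using (_≡_; refl; sym; trans; cong; subst)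
  import Data.Rational as ℚ
  import Data.Rational.Properties as ℚ
  open Counting
  open RowsAndColumns
  open NaturalsAsRationals

  _≟ᶜ_ : DecidableEquality Colour
  red  ≟ᶜ red  = yes refl
  red  ≟ᶜ blue = no λ ()
  blue ≟ᶜ red  = no λ ()
  blue ≟ᶜ blue = yes refl

  Reach-trans : ∀ {κ x y z} → Reach G c κ x y → Reach G c κ y z → Reach G c κ x z
  Reach-trans r here          = r
  Reach-trans r (step r′ a k) = step (Reach-trans r r′) a k

  Reach-sym : ∀ {κ x y} → Reach G c κ x y → Reach G c κ y x
  Reach-sym here                 = here
  Reach-sym (step {u} {w} r a k) =
    Reach-trans (step here (trans (Graph.sym G w u) a) (trans (colSym c w u) k)) (Reach-sym r)

  Reach-isEquivalence : ∀ κ → IsEquivalence (Reach G c κ)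
  Reach-isEquivalence κ = record { refl = here ; sym = Reach-sym ; trans = Reach-trans }

  MonoEdge : Colour → Pred (Fin n × Fin n) 0ℓ
  MonoEdge κ (u , w) = adj G u w ≡ true × col c u w ≡ κ

  monoEdge? : ∀ κ → Decidable (MonoEdge κ)
  monoEdge? κ (u , w) = (adj G u w Bool.≟ true) ×-dec (col c u w ≟ᶜ κ)

  allPairs : List (Fin n × Fin n)
  allPairs = cartesianProduct (allFin n) (allFin n)

  monoEdges : Colour → List (Fin n × Fin n)
  monoEdges κ = filter (monoEdge? κ) allPairs

  open Relabelling (Fin._≟_ {n})

  component : Colour → Fin n → Fin n
  component κ = mergeAll (monoEdges κ) (λ x → x)

  component-reach : ∀ κ {x y} → component κ x ≡ component κ y → Reach G c κ x y
  component-reach κ =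
    mergeAll-sound (Reach-isEquivalence κ) (All.tabulate edge-reach) (id-sound (Reach-isEquivalence κ))
    where
    edge-reach : ∀ {e} → e ∈ monoEdges κ → Reach G c κ (proj₁ e) (proj₂ e)
    edge-reach e∈ = let a , k = proj₂ (∈-filter⁻ (monoEdge? κ) {xs = allPairs} e∈) in step here a k

  component-edge : ∀ {κ u w} → adj G u w ≡ true → col c u w ≡ κ → component κ u ≡ component κ w
  component-edge {κ} {u} {w} a k = mergeAll-joins (monoEdges κ) (λ x → x)
    (∈-filter⁺ (monoEdge? κ) (∈-cartesianProduct⁺ (∈-allFin u) (∈-allFin w)) (a , k))

  edge-joins : ∀ {u w} → adj G u w ≡ true →
               component red u ≡ component red w ⊎ component blue u ≡ component blue w
  edge-joins {u} {w} a with col c u w in k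
  ... | red  = inj₁ (component-edge a k)
  ... | blue = inj₂ (component-edge a k)

  row column : Fin n → ℕ
  row    = toℕ ∘ component red
  column = toℕ ∘ component blue

  row<n : ∀ x → row x < n
  row<n x = toℕ<n (component red x)

  column<n : ∀ x → column x < n
  column<n x = toℕ<n (component blue x)

  apart⇒no-edge : ∀ {A B : Pred (Fin n) 0ℓ} {u v} → Apart row column A B → A u → B v → adj G u v ≡ false
  apart⇒no-edge {u = u} {v} apart a b = ¬-not λ edge → unjoined (edge-joins edge)
    where
    unjoined : ¬ (component red u ≡ component red v ⊎ component blue u ≡ component blue v)
    unjoined (inj₁ same-row)    = proj₁ (apart a b) (cong toℕ same-row)
    unjoined (inj₂ same-column) = proj₂ (apart a b) (cong toℕ same-column)

  P2⇒apart⇒small : ∀ {z Y} → P2 G z → z ℚ.≤ ℕ→ℚ (suc Y) →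
                   ∀ {A B : Pred (Fin n) 0ℓ} (A? : Decidable A) (B? : Decidable B) →
                   Apart row column A B → Y < count A? (allFin n) → count B? (allFin n) ≤ Y
  P2⇒apart⇒small {z} {Y} p2 z≤1+Y {A} {B} A? B? apart Y<A = ≮⇒≥ λ Y<B → p2
    ( filter A? (allFin n) , filter B? (allFin n)
    , filter⁺ A? (allFin⁺ n) , filter⁺ B? (allFin⁺ n)
    , (λ u∈A u∈B → proj₁ (apart (in-A u∈A) (in-B u∈B)) refl)
    , large Y<A , large Y<B
    , (λ u∈A v∈B → apart⇒no-edge apart (in-A u∈A) (in-B v∈B)) )
    where
    large : ∀ {k} → Y < k → z ℚ.≤ ℕ→ℚ k
    large {k} Y<k = ℚ.≤-trans z≤1+Y (ℕ→ℚ-mono-≤ {suc Y} {k} Y<k)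
    in-A : ∀ {u} → u ∈ filter A? (allFin n) → A u
    in-A u∈A = proj₂ (∈-filter⁻ A? {xs = allFin n} u∈A)
    in-B : ∀ {u} → u ∈ filter B? (allFin n) → B u
    in-B u∈B = proj₂ (∈-filter⁻ B? {xs = allFin n} u∈B)

  class? : ∀ κ ℓ → Decidable (λ x → toℕ (component κ x) ≡ ℓ)
  class? κ ℓ x = toℕ (component κ x) ≟ ℓ

  large-monochromatic-class : ∀ {z Y} → P2 G z → z ℚ.≤ ℕ→ℚ (suc Y) →
                              ∃[ κ ] ∃[ ℓ ] length (allFin n) ≤ count (class? κ ℓ) (allFin n) + 5 * Y
  large-monochromatic-class {Y = Y} p2 z≤1+Y = [ (red ,_) , (blue ,_) ]′ large-line
    where open Grid (allFin n) row column row<n column<n Y (P2⇒apart⇒small p2 z≤1+Y)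

  connected⇒BigMonoComponent : ∀ {m} κ → Fin n → (S : List (Fin n)) → Unique S →
                               (∀ {x y} → x ∈ S → y ∈ S → Reach G c κ x y) →
                               m ℚ.≤ ℕ→ℚ (length S) → BigMonoComponent G c m
  connected⇒BigMonoComponent κ v₀ []      unique _         large = κ , v₀ , [] , unique , (λ ()) , large
  connected⇒BigMonoComponent κ _  (v ∷ S) unique connected large =
    κ , v , v ∷ S , unique , connected (here refl) , large

  large-class⇒BigMonoComponent : ∀ {z Y} → Fin n → ℕ→ℚ Y ℚ.≤ z → ∀ κ ℓ →
                                 length (allFin n) ≤ count (class? κ ℓ) (allFin n) + 5 * Y →
                                 BigMonoComponent G c (ℕ→ℚ n ℚ.- ℕ→ℚ 8 ℚ.* z)
  large-class⇒BigMonoComponent {Y = Y} v₀ Y≤z κ ℓ large =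
    connected⇒BigMonoComponent κ v₀ class (filter⁺ (class? κ ℓ) (allFin⁺ n)) connected
      (n≤s+5Y⇒n-8z≤s {s = length class} {Y} Y≤z
        (subst (_≤ length class + 5 * Y) (length-tabulate {n = n} (λ x → x)) large))
    where
    class : List (Fin n)
    class = filter (class? κ ℓ) (allFin n)
    in-class : ∀ {x} → x ∈ class → toℕ (component κ x) ≡ ℓ
    in-class x∈ = proj₂ (∈-filter⁻ (class? κ ℓ) {xs = allFin n} x∈)
    connected : ∀ {x y} → x ∈ class → y ∈ class → Reach G c κ x y
    connected x∈ y∈ = component-reach κ (toℕ-injective (trans (in-class x∈) (sym (in-class y∈))))

open import Data.Rational using (ℚ; 0ℚ; _<_; _-_; _*_)
open import Data.Rational.Properties using (<⇒≤)
open import Data.Product using (_,_; proj₁)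
open NaturalsAsRationals using (ℕ-floor)

lemma4p8 : (z : ℚ) → 0ℚ < z → (n : ℕ) → (G : Graph n) → P1 G z → P2 G z →
    (c : EdgeColouring G) → IsNAC G c →
    BigMonoComponent G c (ℕ→ℚ n - ℕ→ℚ 8 * z)
lemma4p8 z 0<z n G _ p2 c nac =
  let Y , Y≤z , z≤1+Y = ℕ-floor z (<⇒≤ 0<z)
      κ , ℓ , large   = large-monochromatic-class {Y = Y} p2 z≤1+Y
  in  large-class⇒BigMonoComponent {Y = Y} (proj₁ (IsNAC.hasRed nac)) Y≤z κ ℓ large
  where open MonochromaticComponents G c
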